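{- For every integer $n\ge 2$, the strong hub cover pebbling number of the star $S_n$ satisfies $h_s^*(S_n)=n+1$.
   Context: All graphs are finite, simple and connected. For $n\ge 2$, the star $S_n$ is the graph on $n+1$ vertices obtained by joining $n$ pairwise nonadjacent vertices to a single universal vertex (the center). A configuration of pebbles assigns a nonnegative integer number of pebbles to each vertex. A pebbling move consists of choosing adjacent vertices $u,v$ where $u$ has at least two pebbles, removing two pebbles from $u$ and adding one pebble to $v$. A nonempty vertex set $U$ of a graph $G$ is a strong hub set if for any two vertices of $G$ there is a path between them all of whose internal vertices lie in $U$ (a path with no internal vertices qualifies). The strong hub cover pebbling number $h_s^*(G)$ is the smallest integer $t$ such that for every configuration with $t$ pebbles on $G$, one can perform a sequence of pebbling moves after which there is a strong hub set $U$ with every vertex of $U$ having at least one pebble. -}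

module Defs where

open import Data.Nat using (ℕ; zero; suc; _+_; _∸_; _≤_; _<_)
open import Data.Fin using (Fin; zero; suc; _≟_)
open import Data.Fin.Subset using (Subset; _∈_; Nonempty)
open import Data.List using (List; []; _∷_; _++_; [_]; map; allFin)
open import Data.Nat.ListAction using (sum)
open import Data.List.Relation.Unary.All using (All)
open import Data.List.Relation.Unary.Linked using (Linked)
open import Data.List.Relation.Unary.Unique.Propositional using (Unique)
open import Data.Product using (Σ; ∃; _×_)
open import Data.Unit using (⊤)
open import Data.Empty using (⊥)
open import Data.Bool using (if_then_else_)
open import Relation.Nullary using (¬_; does)
open import Relation.Binary.PropositionalEquality using (_≡_)
open import Relation.Binary.Construct.Closure.ReflexiveTransitive using (Star)

AdjRel : ℕ → Set₁
AdjRel m = Fin m → Fin m → Set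

-- The star S_n : vertex set Fin (suc n), center = zero, leaves = suc i.
StarAdj : (n : ℕ) → AdjRel (suc n)
StarAdj n zero    zero    = ⊥
StarAdj n zero    (suc j) = ⊤
StarAdj n (suc i) zero    = ⊤
StarAdj n (suc i) (suc j) = ⊥

Config : ℕ → Set
Config m = Fin m → ℕ

size : {m : ℕ} → Config m → ℕ
size {m} c = sum (map c (allFin m))

move : {m : ℕ} → Config m → Fin m → Fin m → Config m
move c u v w =
  if does (w ≟ u) then c u ∸ 2
  else (if does (w ≟ v) then suc (c v) else c w)

data Step {m : ℕ} (Adj : AdjRel m) : Config m → Config m → Set where
  step : {c : Config m} (u v : Fin m) → Adj u v → 2 ≤ c u → Step Adj c (move c u v)

Reachable : {m : ℕ} → AdjRel m → Config m → Config m → Set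
Reachable Adj = Star (Step Adj)

PathVia : {m : ℕ} → AdjRel m → Subset m → Fin m → Fin m → Set
PathVia {m} Adj U u v =
  Σ (List (Fin m)) λ mid →
    Linked Adj (u ∷ mid ++ [ v ]) × Unique (u ∷ mid ++ [ v ]) × All (_∈ U) mid

IsStrongHubSet : {m : ℕ} → AdjRel m → Subset m → Set
IsStrongHubSet {m} Adj U =
  Nonempty U × ((u v : Fin m) → ¬ u ≡ v → PathVia Adj U u v)

Coverable : {m : ℕ} → AdjRel m → Config m → Set
Coverable {m} Adj c =
  Σ (Config m) λ d → Reachable Adj c d ×
    Σ (Subset m) λ U → IsStrongHubSet Adj U × ((w : Fin m) → w ∈ U → 1 ≤ d w)

Solvable : {m : ℕ} → AdjRel m → ℕ → Set
Solvable {m} Adj t = (c : Config m) → size c ≡ t → Coverable Adj c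

IsStrongHubCoverPebblingNumber : {m : ℕ} → AdjRel m → ℕ → Set
IsStrongHubCoverPebblingNumber Adj t =
  Solvable Adj t × ((s : ℕ) → s < t → ¬ Solvable Adj s)

{-# OPTIONS --safe #-}
-- With n + 1 pebbles on S_n either the center already holds a pebble, or the
-- n leaves hold n + 1 pebbles, so some leaf holds two and can send one to the
-- center; {center} is a strong hub set.  Conversely, for n ≥ 2 every strong
-- hub set contains the center (the only path between two leaves runs through
-- it), and at most n pebbles placed one per leaf admit no move at all, so the
-- center can never be covered.
module Submission where

open import Defs
open import Data.Nat using (ℕ; zero; suc; _+_; _*_; _≤_; _<_; z≤n; s≤s; _≤?_)
open import Data.Nat.Properties using (+-mono-≤; ≰⇒>; <⇒≱; 1+n≰n; *-identityʳ; ≤-refl)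
open import Data.Fin using (Fin; zero; suc)
open import Data.Fin.Properties using (¬∀⟶∃¬)
open import Data.Fin.Subset using (Subset; _∈_; ⁅_⁆)
open import Data.Fin.Subset.Properties using (x∈⁅x⁆; x∈⁅y⁆⇒x≡y)
open import Data.Vec.Functional using (tail) renaming (_∷_ to _∷ᶠ_)
open import Data.List using ([]; _∷_; tabulate)
open import Data.List.Properties using (map-tabulate)
open import Data.Nat.ListAction using (sum)
open import Data.List.Relation.Unary.All using ([]; _∷_)
open import Data.List.Relation.Unary.Linked using ([-]; _∷_)
open import Data.List.Relation.Unary.AllPairs using ([]; _∷_)
open import Data.Product using (Σ; ∃; _×_; _,_; map₂)
open import Data.Unit using (tt)
open import Data.Empty using (⊥-elim)
open import Relation.Nullary using (¬_)
open import Relation.Binary.PropositionalEquality using (_≡_; refl; sym; trans; subst; cong)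
open import Relation.Binary.Construct.Closure.ReflexiveTransitive using (ε; _◅_)

size≡sum-tabulate : {m : ℕ} (c : Config m) → size c ≡ sum (tabulate c)
size≡sum-tabulate c = cong sum (map-tabulate (λ i → i) c)

sum-tabulate-≤ : (n b : ℕ) (g : Fin n → ℕ) → (∀ i → g i ≤ b) → sum (tabulate g) ≤ n * b
sum-tabulate-≤ zero    b g g≤b = z≤n
sum-tabulate-≤ (suc n) b g g≤b =
  +-mono-≤ (g≤b zero) (sum-tabulate-≤ n b (λ i → g (suc i)) (λ i → g≤b (suc i)))

pigeonhole : (n b : ℕ) (g : Fin n → ℕ) → n * b < sum (tabulate g) → ∃ λ i → b < g i
pigeonhole n b g big =
  map₂ ≰⇒> (¬∀⟶∃¬ n (λ i → g i ≤ b) (λ i → g i ≤? b)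
                   (λ g≤b → <⇒≱ big (sum-tabulate-≤ n b g g≤b)))

Sparse : {m : ℕ} → (Fin m → ℕ) → Set
Sparse g = ∀ i → g i ≤ 1

sparse-∷ : {m x : ℕ} {g : Fin m → ℕ} → x ≤ 1 → Sparse g → Sparse (x ∷ᶠ g)
sparse-∷ x≤1 g≤1 zero    = x≤1
sparse-∷ x≤1 g≤1 (suc i) = g≤1 i

sparse-with-sum : (n s : ℕ) → s ≤ n →
                  Σ (Fin n → ℕ) λ g → Sparse g × sum (tabulate g) ≡ s
sparse-with-sum zero    zero    z≤n     = (λ ()) , (λ ()) , refl
sparse-with-sum (suc n) zero    z≤n     with sparse-with-sum n zero z≤n
... | g , g≤1 , sum≡ = 0 ∷ᶠ g , sparse-∷ z≤n g≤1 , sum≡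
sparse-with-sum (suc n) (suc s) (s≤s h) with sparse-with-sum n s h
... | g , g≤1 , sum≡ = 1 ∷ᶠ g , sparse-∷ ≤-refl g≤1 , cong suc sum≡

Reachable-sparse⇒≡ : {m : ℕ} {Adj : AdjRel m} {c d : Config m} →
                     Sparse c → Reachable Adj c d → c ≡ d
Reachable-sparse⇒≡ c≤1 ε                      = refl
Reachable-sparse⇒≡ c≤1 (step u _ _ 2≤cu ◅ _) = ⊥-elim (<⇒≱ 2≤cu (c≤1 u))

center-isStrongHubSet : (n : ℕ) → IsStrongHubSet (StarAdj n) ⁅ zero ⁆
center-isStrongHubSet n = (zero , x∈⁅x⁆ zero) , paths
  where
  paths : (u v : Fin (suc n)) → ¬ u ≡ v → PathVia (StarAdj n) ⁅ zero ⁆ u v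
  paths zero    zero    u≢v = ⊥-elim (u≢v refl)
  paths zero    (suc j) _   = [] , (tt ∷ [-]) , (((λ ()) ∷ []) ∷ [] ∷ []) , []
  paths (suc i) zero    _   = [] , (tt ∷ [-]) , (((λ ()) ∷ []) ∷ [] ∷ []) , []
  paths (suc i) (suc j) i≢j =
    (zero ∷ []) , (tt ∷ tt ∷ [-]) ,
    (((λ ()) ∷ i≢j ∷ []) ∷ ((λ ()) ∷ []) ∷ [] ∷ []) , (x∈⁅x⁆ zero ∷ [])

center∈strongHubSet : (k : ℕ) {U : Subset (suc (suc (suc k)))} →
                      IsStrongHubSet (StarAdj (suc (suc k))) U → zero ∈ U
center∈strongHubSet k (_ , paths) with paths (suc zero) (suc (suc zero)) (λ ())
... | []            , (() ∷ _) , _ , _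
... | (suc _ ∷ _)   , (() ∷ _) , _ , _
... | (zero ∷ _)    , _        , _ , (zero∈U ∷ _) = zero∈U

coverable-if-center-reachable : (n : ℕ) {c d : Config (suc n)} →
                                Reachable (StarAdj n) c d → 1 ≤ d zero →
                                Coverable (StarAdj n) c
coverable-if-center-reachable n {d = d} c↝d 1≤d₀ =
  d , c↝d , ⁅ zero ⁆ , center-isStrongHubSet n , covered
  where
  covered : (w : Fin (suc n)) → w ∈ ⁅ zero ⁆ → 1 ≤ d w
  covered w w∈ rewrite x∈⁅y⁆⇒x≡y zero w∈ = 1≤d₀

coverable-star : (n : ℕ) (c : Config (suc n)) →
                 n < c zero + sum (tabulate (tail c)) → Coverable (StarAdj n) c
coverable-star n c big with c zero in c₀≡
... | suc _ = coverable-if-center-reachable n ε (subst (1 ≤_) (sym c₀≡) (s≤s z≤n))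
... | zero
  with pigeonhole n 1 (tail c) (subst (_< sum (tabulate (tail c))) (sym (*-identityʳ n)) big)
...   | i , 2≤cᵢ = coverable-if-center-reachable n (step (suc i) zero tt 2≤cᵢ ◅ ε) (s≤s z≤n)

solvable-star : (n t : ℕ) → n < t → Solvable (StarAdj n) t
solvable-star n t n<t c size≡t =
  coverable-star n c (subst (n <_) (trans (sym size≡t) (size≡sum-tabulate c)) n<t)

¬coverable-star : (k : ℕ) (c : Config (suc (suc (suc k)))) →
                  Sparse c → c zero ≡ 0 → ¬ Coverable (StarAdj (suc (suc k))) c
¬coverable-star k c c≤1 c₀≡0 (d , c↝d , U , hub , covered)
  with Reachable-sparse⇒≡ c≤1 c↝d | covered zero (center∈strongHubSet k hub)
... | refl | 1≤c₀ = 1+n≰n (subst (1 ≤_) c₀≡0 1≤c₀)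

¬solvable-star : (k s : ℕ) → s ≤ suc (suc k) → ¬ Solvable (StarAdj (suc (suc k))) s
¬solvable-star k s s≤n solvable with sparse-with-sum (suc (suc k)) s s≤n
... | g , g≤1 , sum≡s =
  ¬coverable-star k (0 ∷ᶠ g) (sparse-∷ z≤n g≤1) refl
    (solvable (0 ∷ᶠ g) (trans (size≡sum-tabulate (0 ∷ᶠ g)) sum≡s))

mainTheorem3 : (n : ℕ) → 2 ≤ n → IsStrongHubCoverPebblingNumber (StarAdj n) (suc n)
mainTheorem3 (suc (suc k)) (s≤s (s≤s _)) =
  solvable-star _ _ ≤-refl , λ { s (s≤s s≤n) → ¬solvable-star k s s≤n }
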